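{- For every $n\ge 0$, the number of permutations in $S_n$ that avoid both the classical pattern $3\textrm{ - }1\textrm{ - }2$ and the consecutive pattern $123$ equals the $n$-th Motzkin number $M_n$.
   Context: A permutation $\sigma\in S_n$ avoids the classical pattern $3\textrm{ - }1\textrm{ - }2$ if there are no indices $i<j<l$ with $\sigma(j)<\sigma(l)<\sigma(i)$; it avoids the consecutive pattern $123$ if there is no index $i$ with $\sigma(i)<\sigma(i+1)<\sigma(i+2)$. $M_n$ is the number of lattice paths from $(0,0)$ to $(n,0)$ with steps $(1,1)$, $(1,0)$, $(1,-1)$ never going below the $x$-axis. -}

module Defs where

open import Data.Nat using (ℕ; zero; suc)
open import Data.Bool using (Bool; true; false)
open import Data.Fin using (Fin; toℕ; _<_)
open import Data.Vec using (Vec; lookup)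
open import Data.List using (List; []; _∷_; length; map; concatMap; filterᵇ)
open import Data.Product using (∃; _×_; Σ)
open import Relation.Nullary using (¬_)
open import Relation.Binary.PropositionalEquality using (_≡_)

-- Permutations of [n] in one-line notation: σ(i) = lookup σ i,
-- positions and values in Fin n (= {0,…,n-1}).

IsPerm : ∀ {n} → Vec (Fin n) n → Set
IsPerm {n} σ = ∀ (i j : Fin n) → lookup σ i ≡ lookup σ j → i ≡ j

Avoids312 : ∀ {n} → Vec (Fin n) n → Set
Avoids312 {n} σ =
  ¬ (∃ λ (i : Fin n) → ∃ λ (j : Fin n) → ∃ λ (l : Fin n) →
       i < j × j < l × lookup σ j < lookup σ l × lookup σ l < lookup σ i)

Avoids123 : ∀ {n} → Vec (Fin n) n → Set
Avoids123 {n} σ =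
  ¬ (∃ λ (i : Fin n) → ∃ λ (j : Fin n) → ∃ λ (k : Fin n) →
       toℕ j ≡ suc (toℕ i) × toℕ k ≡ suc (toℕ j) ×
       lookup σ i < lookup σ j × lookup σ j < lookup σ k)

-- Motzkin paths: sequences of n steps U=(1,1), F=(1,0), D=(1,-1)
-- from (0,0) to (n,0) never going below the x-axis.

data Step : Set where
  U F D : Step

isMotzkinFrom : ℕ → List Step → Bool
isMotzkinFrom zero    []       = true
isMotzkinFrom (suc h) []       = false
isMotzkinFrom h       (U ∷ s)  = isMotzkinFrom (suc h) s
isMotzkinFrom h       (F ∷ s)  = isMotzkinFrom h s
isMotzkinFrom zero    (D ∷ s)  = false
isMotzkinFrom (suc h) (D ∷ s)  = isMotzkinFrom h s

allStepSeqs : ℕ → List (List Step)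
allStepSeqs zero    = [] ∷ []
allStepSeqs (suc n) = concatMap (λ st → map (st ∷_) (allStepSeqs n)) (U ∷ F ∷ D ∷ [])

motzkin : ℕ → ℕ
motzkin n = length (filterᵇ (isMotzkinFrom zero) (allStepSeqs n))

-- A Motzkin path is empty, F w, or U w D w′ with w, w′ Motzkin paths (first return to the
-- axis), so Motzkin paths of length n are the paths of the unary-binary trees of size n.
-- These trees are mapped bijectively onto the permutations avoiding 3-1-2 and consecutive
-- 123.  Such a permutation of {0,…,n} splits at its minimum as (α+1) 0 (β+|α|+1): avoiding
-- 3-1-2 forces everything before 0 below everything after it, and the whole avoids both
-- patterns iff α and β do and β does not begin with an ascent.  A 3-1-2-avoiding β that
-- begins with a descent c, d has c = d + 1 (otherwise c, d, d + 1 is a 3-1-2), so it arises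
-- from a permutation of one element fewer by inserting head + 1 in front, an operation that
-- preserves both avoidance properties.  Unary nodes give β = [], binary nodes β of this form.

module Submission where

open import Defs
open import Data.Nat using (ℕ; zero; suc; _+_; _∸_; _≤_; _<_; z≤n; s≤s; z<s; s<s; s≤s⁻¹; s<s⁻¹; _<?_; _≟_)
open import Data.Nat.Properties
open import Data.Nat.Induction using (<-rec)
open import Data.Bool using (T)
open import Data.Bool.Properties using (T?)
open import Data.Unit using (tt)
open import Data.Maybe using (fromMaybe)
open import Data.Fin as Fin using (Fin; toℕ; fromℕ<)
open import Data.Fin.Properties using (toℕ-injective; toℕ<n; toℕ-fromℕ<)
import Data.Fin.Properties as Finₚ
open import Data.Vec using (Vec; []; _∷_; lookup; toList)
open import Data.List using (List; []; _∷_; length; map; _++_; upTo; head; foldr; filterᵇ)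
open import Data.List.Properties using (length-map; length-++; length-++-sucʳ; length-upTo; map-injective; ∷-injective)
open import Data.List.Membership.Propositional using (_∈_)
open import Data.List.Membership.Propositional.Properties
  using (∈-map⁺; ∈-map⁻; ∈-++⁺ˡ; ∈-++⁺ʳ; ∈-++⁻; ∈-∃++; ∈-upTo⁺; ∈-upTo⁻;
         ∈-cartesianProductWith⁺; ∈-cartesianProductWith⁻; ∈-filter⁺; ∈-filter⁻)
open import Data.List.Membership.DecPropositional _≟_ using (_∈?_)
open import Data.List.Relation.Binary.Subset.Propositional using (_⊆_)
open import Data.List.Relation.Unary.Any as Any using (Any; here; there)
import Data.List.Relation.Unary.Any.Properties as Any
open import Data.List.Relation.Unary.All as All using (All; []; _∷_)
open import Data.List.Relation.Unary.All.Properties as All using (All¬⇒¬Any)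
open import Data.List.Relation.Unary.Unique.Propositional using (Unique; []; _∷_)
import Data.List.Relation.Unary.Unique.Propositional.Properties as Unique
open import Data.Product using (Σ; _×_; _,_; proj₁; proj₂; ∃; ∃₂)
import Data.Product as Product
open import Data.Sum using (_⊎_; inj₁; inj₂)
import Data.Sum as Sum
open import Data.Empty using (⊥; ⊥-elim)
open import Function using (_∘_)
open import Function.Bundles using (_⇔_; mk⇔)
import Function.Properties.Equivalence as ⇔
open import Relation.Binary.Core using (_Preserves_⟶_)
open import Relation.Binary.Definitions using (tri<; tri≈; tri>)
open import Relation.Nullary using (¬_; yes; no)
open import Relation.Binary.PropositionalEquality

module StrictlyMonotone {f : ℕ → ℕ} (f-mono : f Preserves _<_ ⟶ _<_) where

  reflects : ∀ {u v} → f u < f v → u < v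
  reflects {u} {v} fu<fv with <-cmp u v
  ... | tri< u<v _ _ = u<v
  ... | tri≈ _ refl _ = ⊥-elim (<-irrefl refl fu<fv)
  ... | tri> _ _ v<u = ⊥-elim (<-asym fu<fv (f-mono v<u))

  injective : ∀ {u v} → f u ≡ f v → u ≡ v
  injective {u} {v} fu≡fv with <-cmp u v
  ... | tri< u<v _ _ = ⊥-elim (<-irrefl fu≡fv (f-mono u<v))
  ... | tri≈ _ u≡v _ = u≡v
  ... | tri> _ _ v<u = ⊥-elim (<-irrefl (sym fu≡fv) (f-mono v<u))

punchIn : ℕ → ℕ → ℕ
punchIn p v with v <? p
... | yes _ = v
... | no  _ = suc v

punchIn-mono : ∀ p → punchIn p Preserves _<_ ⟶ _<_
punchIn-mono p {u} {v} u<v with u <? p | v <? p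
... | yes _   | yes _   = u<v
... | yes _   | no  _   = m<n⇒m<1+n u<v
... | no  u≮p | yes v<p = ⊥-elim (u≮p (<-trans u<v v<p))
... | no  _   | no  _   = s<s u<v

punchIn-< : ∀ {p v} → v < p → punchIn p v ≡ v
punchIn-< {p} {v} v<p with v <? p
... | yes _   = refl
... | no  v≮p = ⊥-elim (v≮p v<p)

punchIn-≥ : ∀ {p v} → p ≤ v → punchIn p v ≡ suc v
punchIn-≥ {p} {v} p≤v with v <? p
... | yes v<p = ⊥-elim (<-irrefl refl (<-≤-trans v<p p≤v))
... | no  _   = refl

punchIn-≢ : ∀ p v → punchIn p v ≢ p
punchIn-≢ p v eq with v <? p
... | yes v<p = <-irrefl eq v<p
... | no  v≮p = v≮p (subst (v <_) eq (n<1+n v))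

v≤punchIn : ∀ p v → v ≤ punchIn p v
v≤punchIn p v with v <? p
... | yes _ = ≤-refl
... | no  _ = n≤1+n v

punchIn≤suc : ∀ p v → punchIn p v ≤ suc v
punchIn≤suc p v with v <? p
... | yes _ = n≤1+n v
... | no  _ = ≤-refl

punchOut : ℕ → ℕ → ℕ
punchOut p v with p <? v
... | yes _ = v ∸ 1
... | no  _ = v

punchIn-punchOut : ∀ {p v} → v ≢ p → punchIn p (punchOut p v) ≡ v
punchIn-punchOut {p} {suc v} v≢p with p <? suc v
... | yes (s≤s p≤v) = punchIn-≥ p≤v
... | no  p≮v       = punchIn-< (≤∧≢⇒< (≮⇒≥ p≮v) v≢p)
punchIn-punchOut {p} {zero} v≢p = punchIn-< (≤∧≢⇒< z≤n v≢p)

punchOut-< : ∀ {p v n} → p ≤ n → v ≢ p → v < suc n → punchOut p v < n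
punchOut-< {p} {v} p≤n v≢p v<1+n with p <? v
... | yes p<v = ∸-monoˡ-< v<1+n (≤-trans (s≤s z≤n) p<v)
... | no  p≮v = <-≤-trans (≤∧≢⇒< (≮⇒≥ p≮v) v≢p) p≤n

map-punchIn-punchOut : ∀ {p xs} → All (_≢ p) xs → map (punchIn p) (map (punchOut p) xs) ≡ xs
map-punchIn-punchOut []            = refl
map-punchIn-punchOut (x≢p ∷ xs≢p) = cong₂ _∷_ (punchIn-punchOut x≢p) (map-punchIn-punchOut xs≢p)

-- Pattern occurrences in lists

data Ascent (P : ℕ → Set) : List ℕ → Set where
  here  : ∀ {a xs} → Any (λ b → a < b × P b) xs → Ascent P (a ∷ xs)
  there : ∀ {a xs} → Ascent P xs → Ascent P (a ∷ xs)

data Has312 : List ℕ → Set where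
  here  : ∀ {c xs} → Ascent (_< c) xs → Has312 (c ∷ xs)
  there : ∀ {c xs} → Has312 xs → Has312 (c ∷ xs)

data Has123 : List ℕ → Set where
  here  : ∀ {a b c xs} → a < b → b < c → Has123 (a ∷ b ∷ c ∷ xs)
  there : ∀ {a xs} → Has123 xs → Has123 (a ∷ xs)

Avoiding : List ℕ → Set
Avoiding xs = ¬ Has312 xs × ¬ Has123 xs

LeadingAscent : List ℕ → Set
LeadingAscent (a ∷ b ∷ _) = a < b
LeadingAscent _           = ⊥

ascent-mono : ∀ {P Q : ℕ → Set} {xs} → (∀ {b} → P b → Q b) → Ascent P xs → Ascent Q xs
ascent-mono P⇒Q (here any)  = here (Any.map (Product.map₂ P⇒Q) any)
ascent-mono P⇒Q (there asc) = there (ascent-mono P⇒Q asc)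

ascent⇒any : ∀ {P xs} → Ascent P xs → Any P xs
ascent⇒any (here any)  = there (Any.map proj₂ any)
ascent⇒any (there asc) = there (ascent⇒any asc)

module _ {f : ℕ → ℕ} (f-mono : f Preserves _<_ ⟶ _<_) where
  open StrictlyMonotone f-mono

  ascent-map⁺ : ∀ {P xs} → Ascent (P ∘ f) xs → Ascent P (map f xs)
  ascent-map⁺ (here any)  = here (Any.map⁺ (Any.map (Product.map₁ f-mono) any))
  ascent-map⁺ (there asc) = there (ascent-map⁺ asc)

  ascent-map⁻ : ∀ {P} xs → Ascent P (map f xs) → Ascent (P ∘ f) xs
  ascent-map⁻ (_ ∷ _)  (here any)  = here (Any.map (Product.map₁ reflects) (Any.map⁻ any))
  ascent-map⁻ (_ ∷ xs) (there asc) = there (ascent-map⁻ xs asc)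

  has312-map⁺ : ∀ {xs} → Has312 xs → Has312 (map f xs)
  has312-map⁺ (here asc) = here (ascent-map⁺ (ascent-mono f-mono asc))
  has312-map⁺ (there h)  = there (has312-map⁺ h)

  has312-map⁻ : ∀ xs → Has312 (map f xs) → Has312 xs
  has312-map⁻ (_ ∷ xs) (here asc) = here (ascent-mono reflects (ascent-map⁻ xs asc))
  has312-map⁻ (_ ∷ xs) (there h)  = there (has312-map⁻ xs h)

  has123-map⁺ : ∀ {xs} → Has123 xs → Has123 (map f xs)
  has123-map⁺ (here a<b b<c) = here (f-mono a<b) (f-mono b<c)
  has123-map⁺ (there h)      = there (has123-map⁺ h)

  has123-map⁻ : ∀ xs → Has123 (map f xs) → Has123 xs
  has123-map⁻ (_ ∷ _ ∷ _ ∷ _) (here a<b b<c) = here (reflects a<b) (reflects b<c)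
  has123-map⁻ (_ ∷ xs)        (there h)      = there (has123-map⁻ xs h)

  avoiding-map⁻ : ∀ xs → Avoiding (map f xs) → Avoiding xs
  avoiding-map⁻ xs (¬312 , ¬123) = ¬312 ∘ has312-map⁺ , ¬123 ∘ has123-map⁺

ascent-++⁺ˡ : ∀ {P xs ys} → Ascent P xs → Ascent P (xs ++ ys)
ascent-++⁺ˡ (here any)  = here (Any.++⁺ˡ any)
ascent-++⁺ˡ (there asc) = there (ascent-++⁺ˡ asc)

ascent-++⁺ʳ : ∀ {P ys} xs → Ascent P ys → Ascent P (xs ++ ys)
ascent-++⁺ʳ []       asc = asc
ascent-++⁺ʳ (_ ∷ xs) asc = there (ascent-++⁺ʳ xs asc)

has312-++⁺ˡ : ∀ {xs ys} → Has312 xs → Has312 (xs ++ ys)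
has312-++⁺ˡ (here asc) = here (ascent-++⁺ˡ asc)
has312-++⁺ˡ (there h)  = there (has312-++⁺ˡ h)

has312-++⁺ʳ : ∀ {ys} xs → Has312 ys → Has312 (xs ++ ys)
has312-++⁺ʳ []       h = h
has312-++⁺ʳ (_ ∷ xs) h = there (has312-++⁺ʳ xs h)

has123-++⁺ˡ : ∀ {xs ys} → Has123 xs → Has123 (xs ++ ys)
has123-++⁺ˡ (here a<b b<c) = here a<b b<c
has123-++⁺ˡ (there h)      = there (has123-++⁺ˡ h)

has123-++⁺ʳ : ∀ {ys} xs → Has123 ys → Has123 (xs ++ ys)
has123-++⁺ʳ []       h = h
has123-++⁺ʳ (_ ∷ xs) h = there (has123-++⁺ʳ xs h)

avoiding-++⁻ˡ : ∀ {ys} xs → Avoiding (xs ++ ys) → Avoiding xs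
avoiding-++⁻ˡ xs (¬312 , ¬123) = ¬312 ∘ has312-++⁺ˡ , ¬123 ∘ has123-++⁺ˡ

avoiding-++⁻ʳ : ∀ {ys} xs → Avoiding (xs ++ ys) → Avoiding ys
avoiding-++⁻ʳ xs (¬312 , ¬123) = ¬312 ∘ has312-++⁺ʳ xs , ¬123 ∘ has123-++⁺ʳ xs

-- An occurrence meeting the minimum 0 can only use it as its 1.
ascent-++0⁻ : ∀ {P ys} xs → Ascent P (xs ++ 0 ∷ ys) → Ascent P xs ⊎ Any P ys
ascent-++0⁻ []       (here any)  = inj₂ (Any.map proj₂ any)
ascent-++0⁻ []       (there asc) = inj₂ (ascent⇒any asc)
ascent-++0⁻ (_ ∷ xs) (here any) with Any.++⁻ xs any
... | inj₁ any′              = inj₁ (here any′)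
... | inj₂ (here (a<0 , _))  = ⊥-elim (n≮0 a<0)
... | inj₂ (there any′)      = inj₂ (Any.map proj₂ any′)
ascent-++0⁻ (_ ∷ xs) (there asc) = Sum.map₁ there (ascent-++0⁻ xs asc)

has312-++0⁻ : ∀ {ys} xs → Has312 (xs ++ 0 ∷ ys) →
              Has312 xs ⊎ Has312 ys ⊎ Any (λ c → Any (_< c) ys) xs
has312-++0⁻ []       (here asc) = ⊥-elim (n≮0 (proj₂ (Any.satisfied (ascent⇒any asc))))
has312-++0⁻ []       (there h)  = inj₂ (inj₁ h)
has312-++0⁻ (_ ∷ xs) (here asc) with ascent-++0⁻ xs asc
... | inj₁ asc′ = inj₁ (here asc′)
... | inj₂ any  = inj₂ (inj₂ (here any))
has312-++0⁻ (_ ∷ xs) (there h) = Sum.map there (Sum.map₂ there) (has312-++0⁻ xs h)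

has312-straddle : ∀ {ys} xs → Any (λ c → Any (λ b → 0 < b × b < c) ys) xs → Has312 (xs ++ 0 ∷ ys)
has312-straddle (_ ∷ xs) (here any)  = here (ascent-++⁺ʳ xs (here any))
has312-straddle (_ ∷ xs) (there any) = there (has312-straddle xs any)

has123-++0⁻ : ∀ {ys} xs → Has123 (xs ++ 0 ∷ ys) → Has123 xs ⊎ Has123 (0 ∷ ys)
has123-++0⁻ []                (here a<b b<c) = inj₂ (here a<b b<c)
has123-++0⁻ []                (there h)      = inj₂ (there h)
has123-++0⁻ (_ ∷ [])          (here () _)
has123-++0⁻ (_ ∷ _ ∷ [])      (here _ ())
has123-++0⁻ (_ ∷ _ ∷ _ ∷ _)   (here a<b b<c) = inj₁ (here a<b b<c)
has123-++0⁻ (_ ∷ xs)          (there h)      = Sum.map₁ there (has123-++0⁻ xs h)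

ascent-≤⇒< : ∀ {x xs} → All (x ≢_) xs → Ascent (_< suc x) xs → Ascent (_< x) xs
ascent-≤⇒< (_ ∷ x∉xs) (here any)  = here (top<x x∉xs any)
  where
  top<x : ∀ {x a ys} → All (x ≢_) ys → Any (λ b → a < b × b < suc x) ys → Any (λ b → a < b × b < x) ys
  top<x (x≢y ∷ _) (here (a<y , y<1+x)) = here (a<y , ≤∧≢⇒< (s≤s⁻¹ y<1+x) (x≢y ∘ sym))
  top<x (_ ∷ x∉ys) (there any)          = there (top<x x∉ys any)
ascent-≤⇒< (_ ∷ x∉xs) (there asc) = there (ascent-≤⇒< x∉xs asc)

has123-head : ∀ {a xs} → Has123 (a ∷ xs) → LeadingAscent (a ∷ xs) ⊎ Has123 xs
has123-head (here a<b _) = inj₁ a<b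
has123-head (there h)    = inj₂ h

-- Permutations as lists of values

record IsPermList (n : ℕ) (xs : List ℕ) : Set where
  field
    length≡ : length xs ≡ n
    unique  : Unique xs
    bounded : All (_< n) xs

Unique⇒length≤ : ∀ {A : Set} {xs ys : List A} → Unique xs → xs ⊆ ys → length xs ≤ length ys
Unique⇒length≤ {xs = []}     _            _     = z≤n
Unique⇒length≤ {xs = x ∷ xs} (x∉xs ∷ !xs) xs⊆ys
  with ys₁ , ys₂ , refl ← ∈-∃++ (xs⊆ys (here refl)) =
  subst (suc (length xs) ≤_) (sym (length-++-sucʳ ys₁ x ys₂)) (s≤s (Unique⇒length≤ !xs xs⊆ys₁ys₂))
  where
  xs⊆ys₁ys₂ : xs ⊆ ys₁ ++ ys₂
  xs⊆ys₁ys₂ v∈xs with ∈-++⁻ ys₁ (xs⊆ys (there v∈xs))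
  ... | inj₁ v∈ys₁         = ∈-++⁺ˡ v∈ys₁
  ... | inj₂ (here refl)   = ⊥-elim (All.lookup x∉xs v∈xs refl)
  ... | inj₂ (there v∈ys₂) = ∈-++⁺ʳ ys₁ v∈ys₂

unique-bounded⇒length≤ : ∀ {n xs} → Unique xs → All (_< n) xs → length xs ≤ n
unique-bounded⇒length≤ {n} !xs xs<n =
  subst (_ ≤_) (length-upTo n) (Unique⇒length≤ !xs (∈-upTo⁺ ∘ All.lookup xs<n))

perm-∈ : ∀ {n xs v} → IsPermList n xs → v < n → v ∈ xs
perm-∈ {n} {xs} {v} π v<n with v ∈? xs
... | yes v∈xs = v∈xs
... | no  v∉xs = ⊥-elim (<-irrefl length≡ (unique-bounded⇒length≤ (v≢xs ∷ unique) (v<n ∷ bounded)))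
  where
  open IsPermList π
  v≢xs : All (v ≢_) xs
  v≢xs = All.tabulate λ { x∈xs refl → v∉xs x∈xs }

unique-++⁻ˡ : ∀ {ys : List ℕ} xs → Unique (xs ++ ys) → Unique xs
unique-++⁻ˡ []       _            = []
unique-++⁻ˡ (_ ∷ xs) (x∉xs ∷ !xs) = All.++⁻ˡ xs x∉xs ∷ unique-++⁻ˡ xs !xs

unique-++⁻ʳ : ∀ {ys : List ℕ} xs → Unique (xs ++ ys) → Unique ys
unique-++⁻ʳ []       !ys      = !ys
unique-++⁻ʳ (_ ∷ xs) (_ ∷ !xs) = unique-++⁻ʳ xs !xs

unique-++-disjoint : ∀ {x y : ℕ} {ys} xs → Unique (xs ++ ys) → x ∈ xs → y ∈ ys → x ≢ y
unique-++-disjoint (_ ∷ xs) (x∉ ∷ _)  (here refl) y∈ys = All.lookup x∉ (∈-++⁺ʳ xs y∈ys)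
unique-++-disjoint (_ ∷ xs) (_ ∷ !xs) (there x∈xs) y∈ys = unique-++-disjoint xs !xs x∈xs y∈ys

map-+-∸ : ∀ {d xs} → All (d ≤_) xs → map (d +_) (map (_∸ d) xs) ≡ xs
map-+-∸ []           = refl
map-+-∸ (d≤x ∷ d≤xs) = cong₂ _∷_ (m+[n∸m]≡n d≤x) (map-+-∸ d≤xs)

∸-perm : ∀ {d xs} → Unique xs → All (λ x → d ≤ x × x < d + length xs) xs →
         IsPermList (length xs) (map (_∸ d) xs)
∸-perm {d} {xs} !xs bounds = record
  { length≡ = length-map (_∸ d) xs
  ; unique  = Unique.map⁻ (subst Unique (sym (map-+-∸ (All.map proj₁ bounds))) !xs)
  ; bounded = All.map⁺ (All.map below bounds)
  }
  where
  below : ∀ {x} → d ≤ x × x < d + length xs → x ∸ d < length xs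
  below (d≤x , x<d+l) = subst (_ <_) (m+n∸m≡n d (length xs)) (∸-monoˡ-< x<d+l d≤x)

-- Splitting at the minimum

minJoin : List ℕ → List ℕ → List ℕ
minJoin α β = map suc α ++ 0 ∷ map (suc (length α) +_) β

module _ {α β : List ℕ} where
  private
    k′ : ℕ
    k′ = suc (length α)

  minJoin-perm : ∀ {k m} → IsPermList k α → IsPermList m β → IsPermList (suc (k + m)) (minJoin α β)
  minJoin-perm {m = m} πα@record { length≡ = refl } πβ = record
    { length≡ = begin
        length (map suc α ++ 0 ∷ map (k′ +_) β)           ≡⟨ length-++-sucʳ (map suc α) 0 _ ⟩
        suc (length (map suc α ++ map (k′ +_) β))         ≡⟨ cong suc (length-++ (map suc α)) ⟩
        suc (length (map suc α) + length (map (k′ +_) β))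
          ≡⟨ cong suc (cong₂ _+_ (length-map suc α) (length-map _ β)) ⟩
        suc (length α + length β)
          ≡⟨ cong (λ l → suc (length α + l)) (IsPermList.length≡ πβ) ⟩
        suc (length α + m)                                 ∎
    ; unique  = Unique.++⁺ (Unique.map⁺ suc-injective (IsPermList.unique πα))
                           (All.map⁺ (All.universal (λ _ ()) β) ∷
                            Unique.map⁺ (StrictlyMonotone.injective (+-monoʳ-< k′)) (IsPermList.unique πβ))
                           disjoint
    ; bounded = All.++⁺ (All.map⁺ (All.map (λ a<k → s<s (<-≤-trans a<k (m≤m+n _ m))) (IsPermList.bounded πα)))
                        (z<s ∷ All.map⁺ (All.map (λ y<m → s<s (+-monoʳ-< (length α) y<m))
                                                 (IsPermList.bounded πβ)))
    }
    where
    open ≡-Reasoning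
    low : All (λ v → 0 < v × v < k′) (map suc α)
    low = All.map⁺ (All.map (λ a<k → z<s , s<s a<k) (IsPermList.bounded πα))
    high : All (k′ ≤_) (map (k′ +_) β)
    high = All.map⁺ (All.universal (m≤m+n k′) β)
    disjoint : ∀ {v} → v ∈ map suc α × v ∈ 0 ∷ map (k′ +_) β → ⊥
    disjoint (v∈ , here refl)  = n≮0 (proj₁ (All.lookup low v∈))
    disjoint (v∈ , there v∈′) = <⇒≱ (proj₂ (All.lookup low v∈)) (All.lookup high v∈′)

  minJoin-avoiding : ∀ {k} → IsPermList k α → Avoiding α → Avoiding β → ¬ LeadingAscent β →
                     Avoiding (minJoin α β)
  minJoin-avoiding record { length≡ = refl ; bounded = α<k } (¬312α , ¬123α) (¬312β , ¬123β) ¬ascβ =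
    ¬312 , ¬123
    where
    ¬312 : ¬ Has312 (minJoin α β)
    ¬312 h with has312-++0⁻ (map suc α) h
    ... | inj₁ h′         = ¬312α (has312-map⁻ s<s α h′)
    ... | inj₂ (inj₁ h′)  = ¬312β (has312-map⁻ (+-monoʳ-< k′) β h′)
    ... | inj₂ (inj₂ c>b) = All¬⇒¬Any (All.map⁺ (All.map left-below-right α<k)) c>b
      where
      left-below-right : ∀ {a} → a < length α → ¬ Any (_< suc a) (map (k′ +_) β)
      left-below-right a<k = All¬⇒¬Any (All.map⁺ (All.universal
        (λ y b<c → <⇒≱ b<c (s≤s (≤-trans (<⇒≤ a<k) (m≤m+n _ y)))) β))
    ¬123-right : ∀ β → ¬ LeadingAscent β → ¬ Has123 β → ¬ Has123 (0 ∷ map (k′ +_) β)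
    ¬123-right (_ ∷ _ ∷ _) ¬asc _ (here _ b<c) = ¬asc (StrictlyMonotone.reflects (+-monoʳ-< k′) b<c)
    ¬123-right β _ ¬123 (there h) = ¬123 (has123-map⁻ (+-monoʳ-< k′) β h)
    ¬123 : ¬ Has123 (minJoin α β)
    ¬123 h with has123-++0⁻ (map suc α) h
    ... | inj₁ h′ = ¬123α (has123-map⁻ s<s α h′)
    ... | inj₂ h′ = ¬123-right β ¬ascβ ¬123β h′

  minJoin-avoiding⁻ : Avoiding (minJoin α β) → Avoiding α × Avoiding β × ¬ LeadingAscent β
  minJoin-avoiding⁻ av =
    avoiding-map⁻ s<s α (avoiding-++⁻ˡ (map suc α) av) ,
    avoiding-map⁻ (+-monoʳ-< k′) β (avoiding-++⁻ʳ (0 ∷ []) av₀) ,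
    ¬leading β (proj₂ av₀)
    where
    av₀ : Avoiding (0 ∷ map (k′ +_) β)
    av₀ = avoiding-++⁻ʳ (map suc α) av
    ¬leading : ∀ β → ¬ Has123 (0 ∷ map (k′ +_) β) → ¬ LeadingAscent β
    ¬leading (_ ∷ _ ∷ _) ¬123 y₀<y₁ = ¬123 (here z<s (+-monoʳ-< k′ y₀<y₁))

map-suc-++0-injective : ∀ a a′ {b b′} → map suc a ++ 0 ∷ b ≡ map suc a′ ++ 0 ∷ b′ →
                        a ≡ a′ × b ≡ b′
map-suc-++0-injective []      []        refl = refl , refl
map-suc-++0-injective (_ ∷ a) (_ ∷ a′)  eq
  with x≡x′ , eq′ ← ∷-injective eq =
  Product.map₁ (cong₂ _∷_ (suc-injective x≡x′)) (map-suc-++0-injective a a′ eq′)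

minJoin-injective : ∀ {α α′ β β′} → minJoin α β ≡ minJoin α′ β′ → α ≡ α′ × β ≡ β′
minJoin-injective {α} {α′} eq with refl , eq′ ← map-suc-++0-injective α α′ eq =
  refl , map-injective (StrictlyMonotone.injective (+-monoʳ-< (suc (length α)))) eq′

module MinimumSplit {n : ℕ} (a b : List ℕ) (π : IsPermList (suc n) (a ++ 0 ∷ b))
                    (¬312 : ¬ Has312 (a ++ 0 ∷ b)) where
  open IsPermList π

  private
    k : ℕ
    k = length a

  length-a0b : suc k + length b ≡ suc n
  length-a0b = trans (cong suc (sym (length-++ a))) (trans (sym (length-++-sucʳ a 0 b)) length≡)

  a≢0 : ∀ {x} → x ∈ a → x ≢ 0
  a≢0 x∈a = unique-++-disjoint a unique x∈a (here refl)

  b>0 : ∀ {y} → y ∈ b → 0 < y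
  b>0 y∈b = n≢0⇒n>0 (All.lookup 0∉b y∈b ∘ sym)
    where
    0∉b : All (0 ≢_) b
    0∉b with 0∉b ∷ _ ← unique-++⁻ʳ a unique = 0∉b

  a<b : ∀ {x y} → x ∈ a → y ∈ b → x < y
  a<b {x} {y} x∈a y∈b with <-cmp x y
  ... | tri< x<y _ _ = x<y
  ... | tri≈ _ x≡y _ = ⊥-elim (unique-++-disjoint a unique x∈a (there y∈b) x≡y)
  ... | tri> _ _ y<x = ⊥-elim (¬312 (has312-straddle a
          (Any.map (λ { refl → Any.map (λ { refl → b>0 y∈b , y<x }) y∈b }) x∈a)))

  -- Since a lies below b, counting shows that a and b consist of 1, …, k and k + 1, …, n.
  a-bounds : All (λ x → 1 ≤ x × x < 1 + k) a
  a-bounds = All.tabulate λ x∈a → n≢0⇒n>0 (a≢0 x∈a) , x≤k x∈a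
    where
    x≤k : ∀ {x} → x ∈ a → x < 1 + k
    x≤k {x} x∈a = subst (_≤ 1 + k) (length-upTo (suc x)) (Unique⇒length≤ (Unique.upTo⁺ (suc x)) below-x)
      where
      below-x : upTo (suc x) ⊆ 0 ∷ a
      below-x {v} v∈
        with ∈-++⁻ a (perm-∈ π (≤-<-trans (s≤s⁻¹ (∈-upTo⁻ v∈)) (All.lookup bounded (∈-++⁺ˡ x∈a))))
      ... | inj₁ v∈a         = there v∈a
      ... | inj₂ (here refl) = here refl
      ... | inj₂ (there v∈b) = ⊥-elim (<⇒≱ (a<b x∈a v∈b) (s≤s⁻¹ (∈-upTo⁻ v∈)))

  b-bounds : All (λ y → suc k ≤ y × y < suc k + length b) b
  b-bounds = All.tabulate λ {y} y∈b →
    above-a y∈b , subst (y <_) (sym length-a0b) (All.lookup bounded (∈-++⁺ʳ a (there y∈b)))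
    where
    above-a : ∀ {y} → y ∈ b → suc k ≤ y
    above-a y∈b = unique-bounded⇒length≤
      (All.tabulate (λ x∈a 0≡x → a≢0 x∈a (sym 0≡x)) ∷ unique-++⁻ˡ a unique)
      (b>0 y∈b ∷ All.tabulate (λ x∈a → a<b x∈a y∈b))

  decompose : ∃₂ λ α β → ∃₂ λ k m →
              k + m ≡ n × IsPermList k α × IsPermList m β × a ++ 0 ∷ b ≡ minJoin α β
  decompose = α , β , k , length b , suc-injective length-a0b ,
          ∸-perm (unique-++⁻ˡ a unique) a-bounds ,
          ∸-perm (unique-++⁻ʳ (0 ∷ []) (unique-++⁻ʳ a unique)) b-bounds ,
          sym (cong₂ (λ l r → l ++ 0 ∷ r) (map-+-∸ (All.map proj₁ a-bounds)) shifted-b)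
    where
    α β : List ℕ
    α = map (_∸ 1) a
    β = map (_∸ suc k) b
    shifted-b : map (suc (length α) +_) β ≡ b
    shifted-b = trans (cong (λ j → map (suc j +_) β) (length-map (_∸ 1) a)) (map-+-∸ (All.map proj₁ b-bounds))

minJoin-surjective : ∀ {n σ} → IsPermList (suc n) σ → ¬ Has312 σ →
  ∃₂ λ α β → ∃₂ λ k m → k + m ≡ n × IsPermList k α × IsPermList m β × σ ≡ minJoin α β
minJoin-surjective π ¬312 with a , b , refl ← ∈-∃++ (perm-∈ π z<s) = MinimumSplit.decompose a b π ¬312

-- Permutations beginning with a descent by one

consSuccHead : List ℕ → List ℕ
consSuccHead []      = 0 ∷ []
consSuccHead (c ∷ g) = suc c ∷ map (punchIn (suc c)) (c ∷ g)

consSuccHead-perm : ∀ {m g} → IsPermList m g → IsPermList (suc m) (consSuccHead g)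
consSuccHead-perm {g = []}    record { length≡ = refl } =
  record { length≡ = refl ; unique = [] ∷ [] ; bounded = z<s ∷ [] }
consSuccHead-perm {m} {c ∷ g} record { length≡ = length≡ ; unique = !g ; bounded = c<m ∷ g<m } = record
  { length≡ = cong suc (trans (length-map _ (c ∷ g)) length≡)
  ; unique  = All.map⁺ (All.universal (λ v → punchIn-≢ (suc c) v ∘ sym) (c ∷ g))
              ∷ Unique.map⁺ (StrictlyMonotone.injective (punchIn-mono (suc c))) !g
  ; bounded = s<s c<m ∷ All.map⁺ (All.map (λ {v} v<m → ≤-<-trans (punchIn≤suc (suc c) v) (s<s v<m)) (c<m ∷ g<m))
  }

consSuccHead-¬leadingAscent : ∀ g → ¬ LeadingAscent (consSuccHead g)
consSuccHead-¬leadingAscent (c ∷ g) 1+c<c′ = <-asym (subst (suc c <_) (punchIn-< (n<1+n c)) 1+c<c′) (n<1+n c)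

consSuccHead-avoiding : ∀ {g} → Unique g → Avoiding g → Avoiding (consSuccHead g)
consSuccHead-avoiding {[]}    _            _              = (λ { (here ()) ; (there ()) }) , (λ { (there ()) })
consSuccHead-avoiding {c ∷ g} (c∉g ∷ _) (¬312 , ¬123) = ¬312′ , ¬123′
  where
  p-mono : punchIn (suc c) Preserves _<_ ⟶ _<_
  p-mono = punchIn-mono (suc c)
  ¬312′ : ¬ Has312 (consSuccHead (c ∷ g))
  ¬312′ (here asc) with ascent-mono (λ {b} → ≤-<-trans (v≤punchIn (suc c) b)) (ascent-map⁻ p-mono (c ∷ g) asc)
  ... | here any    = let _ , c<b , b<1+c = Any.satisfied any in <⇒≱ c<b (s≤s⁻¹ b<1+c)
  ... | there asc′  = ¬312 (here (ascent-≤⇒< c∉g asc′))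
  ¬312′ (there h) = ¬312 (has312-map⁻ p-mono (c ∷ g) h)
  ¬123′ : ¬ Has123 (consSuccHead (c ∷ g))
  ¬123′ h with has123-head h
  ... | inj₁ asc = consSuccHead-¬leadingAscent (c ∷ g) asc
  ... | inj₂ h′  = ¬123 (has123-map⁻ p-mono (c ∷ g) h′)

consSuccHead-avoiding⁻ : ∀ g → Avoiding (consSuccHead g) → Avoiding g
consSuccHead-avoiding⁻ []      _  = (λ ()) , (λ ())
consSuccHead-avoiding⁻ (c ∷ g) av = avoiding-map⁻ (punchIn-mono (suc c)) (c ∷ g) (avoiding-++⁻ʳ (suc c ∷ []) av)

consSuccHead-injective : ∀ {g g′} → consSuccHead g ≡ consSuccHead g′ → g ≡ g′
consSuccHead-injective {[]}    {[]}     refl = refl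
consSuccHead-injective {c ∷ g} {c′ ∷ g′} eq
  with 1+c≡1+c′ , eq′ ← ∷-injective eq
  with refl ← suc-injective 1+c≡1+c′ =
  map-injective (StrictlyMonotone.injective (punchIn-mono (suc c))) eq′

consSuccHead-surjective : ∀ {m β} → IsPermList (suc m) β → ¬ Has312 β → ¬ LeadingAscent β →
                          ∃ λ g → IsPermList m g × β ≡ consSuccHead g
consSuccHead-surjective {β = c ∷ []} record { length≡ = refl ; bounded = z<s ∷ [] } _ _ =
  [] , record { length≡ = refl ; unique = [] ; bounded = [] } , refl
consSuccHead-surjective {suc m} {c ∷ d ∷ ρ} π@record { unique = c∉dρ ∷ !dρ ; bounded = bounded } ¬312 ¬asc =
  descent-by-one (≤∧≢⇒< (≮⇒≥ ¬asc) (All.head c∉dρ ∘ sym))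
  where
  descent-by-one : d < c → ∃ λ g → IsPermList (suc m) g × c ∷ d ∷ ρ ≡ consSuccHead g
  descent-by-one d<c with m≤n⇒m<n∨m≡n d<c
  ... | inj₁ 1+d<c = ⊥-elim (¬312 (from-1+d (perm-∈ π (<-trans 1+d<c (All.head bounded)))))
    where
    from-1+d : suc d ∈ c ∷ d ∷ ρ → Has312 (c ∷ d ∷ ρ)
    from-1+d (here 1+d≡c)          = ⊥-elim (<-irrefl 1+d≡c 1+d<c)
    from-1+d (there (here 1+d≡d))  = ⊥-elim (<-irrefl (sym 1+d≡d) (n<1+n d))
    from-1+d (there (there 1+d∈ρ)) = here (here (Any.map (λ { refl → n<1+n d , 1+d<c }) 1+d∈ρ))
  ... | inj₂ refl = g , πg , cong (suc d ∷_) (sym shape)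
    where
    g : List ℕ
    g = d ∷ map (punchOut (suc d)) ρ
    ρ≢1+d : All (_≢ suc d) ρ
    ρ≢1+d = All.map (_∘ sym) (All.tail c∉dρ)
    shape : map (punchIn (suc d)) g ≡ d ∷ ρ
    shape = cong₂ _∷_ (punchIn-< (n<1+n d)) (map-punchIn-punchOut ρ≢1+d)
    1+d≤1+m : suc d ≤ suc m
    1+d≤1+m = s<s⁻¹ (All.head bounded)
    πg : IsPermList (suc m) g
    πg = record
      { length≡ = cong suc (trans (length-map _ ρ) (suc-injective (suc-injective (IsPermList.length≡ π))))
      ; unique  = Unique.map⁻ (subst Unique (sym shape) !dρ)
      ; bounded = 1+d≤1+m ∷ All.map⁺ (All.tabulate λ v∈ρ →
                    punchOut-< 1+d≤1+m (All.lookup ρ≢1+d v∈ρ) (All.lookup bounded (there (there v∈ρ))))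
      }

-- Motzkin trees, permutations and paths

data MotzkinTree : Set where
  leaf  : MotzkinTree
  node₁ : MotzkinTree → MotzkinTree
  node₂ : MotzkinTree → MotzkinTree → MotzkinTree

size : MotzkinTree → ℕ
size leaf        = 0
size (node₁ t)   = suc (size t)
size (node₂ t s) = suc (suc (size t + size s))

toPerm : MotzkinTree → List ℕ
toPerm leaf        = []
toPerm (node₁ t)   = minJoin (toPerm t) []
toPerm (node₂ t s) = minJoin (toPerm t) (consSuccHead (toPerm s))

empty-perm : IsPermList 0 []
empty-perm = record { length≡ = refl ; unique = [] ; bounded = [] }

toPerm-perm : ∀ t → IsPermList (size t) (toPerm t)
toPerm-perm leaf        = empty-perm
toPerm-perm (node₁ t)   = subst (λ n → IsPermList (suc n) (toPerm (node₁ t))) (+-identityʳ (size t))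
                            (minJoin-perm (toPerm-perm t) empty-perm)
toPerm-perm (node₂ t s) = subst (λ n → IsPermList (suc n) (toPerm (node₂ t s))) (+-suc (size t) (size s))
                            (minJoin-perm (toPerm-perm t) (consSuccHead-perm (toPerm-perm s)))

toPerm-avoiding : ∀ t → Avoiding (toPerm t)
toPerm-avoiding leaf        = (λ ()) , (λ ())
toPerm-avoiding (node₁ t)   = minJoin-avoiding (toPerm-perm t) (toPerm-avoiding t) ((λ ()) , (λ ())) (λ ())
toPerm-avoiding (node₂ t s) = minJoin-avoiding (toPerm-perm t) (toPerm-avoiding t)
  (consSuccHead-avoiding (IsPermList.unique (toPerm-perm s)) (toPerm-avoiding s))
  (consSuccHead-¬leadingAscent (toPerm s))

minJoin≢[] : ∀ α β → minJoin α β ≢ []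
minJoin≢[] []      _ ()
minJoin≢[] (_ ∷ _) _ ()

consSuccHead≢[] : ∀ g → consSuccHead g ≢ []
consSuccHead≢[] []      ()
consSuccHead≢[] (_ ∷ _) ()

toPerm-injective : ∀ {t t′} → toPerm t ≡ toPerm t′ → t ≡ t′
toPerm-injective {leaf}      {leaf}        _  = refl
toPerm-injective {leaf}      {node₁ _}     eq = ⊥-elim (minJoin≢[] _ _ (sym eq))
toPerm-injective {leaf}      {node₂ _ _}   eq = ⊥-elim (minJoin≢[] _ _ (sym eq))
toPerm-injective {node₁ _}   {leaf}        eq = ⊥-elim (minJoin≢[] _ _ eq)
toPerm-injective {node₂ _ _} {leaf}        eq = ⊥-elim (minJoin≢[] _ _ eq)
toPerm-injective {node₁ t}   {node₁ t′}    eq = cong node₁ (toPerm-injective (proj₁ (minJoin-injective eq)))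
toPerm-injective {node₁ _}   {node₂ _ _}   eq = ⊥-elim (consSuccHead≢[] _ (sym (proj₂ (minJoin-injective eq))))
toPerm-injective {node₂ _ _} {node₁ _}     eq = ⊥-elim (consSuccHead≢[] _ (proj₂ (minJoin-injective eq)))
toPerm-injective {node₂ t s} {node₂ t′ s′} eq with eqₗ , eqᵣ ← minJoin-injective eq =
  cong₂ node₂ (toPerm-injective eqₗ) (toPerm-injective (consSuccHead-injective eqᵣ))

toPerm-surjective : ∀ {n σ} → IsPermList n σ → Avoiding σ → ∃ λ t → toPerm t ≡ σ
toPerm-surjective {n} = <-rec Preimage step n
  where
  Preimage : ℕ → Set
  Preimage n = ∀ {σ} → IsPermList n σ → Avoiding σ → ∃ λ t → toPerm t ≡ σ
  step : ∀ n → (∀ {m} → m < n → Preimage m) → Preimage n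
  step zero    _   {[]} _ _ = leaf , refl
  step (suc n) rec π av
    with α , β , k , m , k+m≡n , πα , πβ , refl ← minJoin-surjective π (proj₁ av)
    with avα , avβ , ¬ascβ ← minJoin-avoiding⁻ av
    with tα , refl ← rec (s≤s (subst (k ≤_) k+m≡n (m≤m+n k m))) πα avα =
    extend (subst (m ≤_) k+m≡n (m≤n+m m k)) πβ avβ ¬ascβ
    where
    extend : ∀ {m β} → m ≤ n → IsPermList m β → Avoiding β → ¬ LeadingAscent β →
             ∃ λ t → toPerm t ≡ minJoin (toPerm tα) β
    extend {zero} {[]} _ _ _ _ = node₁ tα , refl
    extend {suc m} m<n πβ avβ ¬ascβ
      with g , πg , refl ← consSuccHead-surjective πβ (proj₁ avβ) ¬ascβ
      with s , refl ← rec (s≤s (≤-trans (n≤1+n m) m<n)) πg (consSuccHead-avoiding⁻ g avβ) =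
      node₂ tα s , refl

pathOnto : MotzkinTree → List Step → List Step
pathOnto leaf        r = r
pathOnto (node₁ t)   r = F ∷ pathOnto t r
pathOnto (node₂ t s) r = U ∷ pathOnto t (D ∷ pathOnto s r)

path : MotzkinTree → List Step
path t = pathOnto t []

length-pathOnto : ∀ t r → length (pathOnto t r) ≡ size t + length r
length-pathOnto leaf        r = refl
length-pathOnto (node₁ t)   r = cong suc (length-pathOnto t r)
length-pathOnto (node₂ t s) r = cong suc (begin
  length (pathOnto t (D ∷ pathOnto s r)) ≡⟨ length-pathOnto t _ ⟩
  size t + suc (length (pathOnto s r))   ≡⟨ cong (λ l → size t + suc l) (length-pathOnto s r) ⟩
  size t + suc (size s + length r)       ≡⟨ +-suc (size t) _ ⟩
  suc (size t + (size s + length r))     ≡⟨ cong suc (+-assoc (size t) (size s) (length r)) ⟨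
  suc (size t + size s + length r)       ∎)
  where open ≡-Reasoning

length-path : ∀ t → length (path t) ≡ size t
length-path t = trans (length-pathOnto t []) (+-identityʳ (size t))

isMotzkinFrom-U : ∀ h w → isMotzkinFrom h (U ∷ w) ≡ isMotzkinFrom (suc h) w
isMotzkinFrom-U zero    w = refl
isMotzkinFrom-U (suc h) w = refl

isMotzkinFrom-F : ∀ h w → isMotzkinFrom h (F ∷ w) ≡ isMotzkinFrom h w
isMotzkinFrom-F zero    w = refl
isMotzkinFrom-F (suc h) w = refl

isMotzkinFrom-pathOnto : ∀ h t r → isMotzkinFrom h (pathOnto t r) ≡ isMotzkinFrom h r
isMotzkinFrom-pathOnto h leaf        r = refl
isMotzkinFrom-pathOnto h (node₁ t)   r = trans (isMotzkinFrom-F h _) (isMotzkinFrom-pathOnto h t r)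
isMotzkinFrom-pathOnto h (node₂ t s) r = trans (isMotzkinFrom-U h _)
  (trans (isMotzkinFrom-pathOnto (suc h) t _) (isMotzkinFrom-pathOnto h s r))

-- parse reads a word from the right with a stack of trees: one for the current level and one
-- for each level still to be opened by a U.  Words that are not Motzkin paths may empty the
-- stack; their trees are junk.
push : Step → List MotzkinTree → List MotzkinTree
push F (t ∷ ts)     = node₁ t ∷ ts
push D ts           = leaf ∷ ts
push U (t ∷ s ∷ ts) = node₂ t s ∷ ts
push _ _            = []

parse : List Step → List MotzkinTree
parse = foldr push (leaf ∷ [])

tree : List Step → MotzkinTree
tree = fromMaybe leaf ∘ head ∘ parse

parse-pathOnto : ∀ t {r ts} → parse r ≡ leaf ∷ ts → parse (pathOnto t r) ≡ t ∷ ts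
parse-pathOnto leaf        eq = eq
parse-pathOnto (node₁ t)   eq = cong (push F) (parse-pathOnto t eq)
parse-pathOnto (node₂ t s) eq = cong (push U) (parse-pathOnto t (cong (push D) (parse-pathOnto s eq)))

tree-path : ∀ t → tree (path t) ≡ t
tree-path t = cong (fromMaybe leaf ∘ head) (parse-pathOnto t refl)

closing : List MotzkinTree → List Step
closing []       = []
closing (s ∷ ss) = D ∷ pathOnto s (closing ss)

parse-complete : ∀ h w → T (isMotzkinFrom h w) →
  ∃₂ λ t (ts : Vec MotzkinTree h) → parse w ≡ t ∷ toList ts × pathOnto t (closing (toList ts)) ≡ w
parse-complete zero    []      _  = leaf , [] , refl , refl
parse-complete h       (F ∷ w) ok
  with t , ts , eq , eq′ ← parse-complete h w (subst T (isMotzkinFrom-F h w) ok) =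
  node₁ t , ts , cong (push F) eq , cong (F ∷_) eq′
parse-complete (suc h) (D ∷ w) ok
  with t , ts , eq , eq′ ← parse-complete h w ok =
  leaf , t ∷ ts , cong (push D) eq , cong (D ∷_) eq′
parse-complete h       (U ∷ w) ok
  with t , s ∷ ts , eq , eq′ ← parse-complete (suc h) w (subst T (isMotzkinFrom-U h w) ok) =
  node₂ t s , ts , cong (push U) eq , cong (U ∷_) eq′

path-tree : ∀ {w} → T (isMotzkinFrom 0 w) → path (tree w) ≡ w
path-tree {w} ok with t , [] , eq , eq′ ← parse-complete 0 w ok =
  trans (cong (path ∘ fromMaybe leaf ∘ head) eq) eq′

step∈steps : ∀ s → s ∈ U ∷ F ∷ D ∷ []
step∈steps U = here refl
step∈steps F = there (here refl)
step∈steps D = there (there (here refl))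

allStepSeqs-unique : ∀ n → Unique (allStepSeqs n)
allStepSeqs-unique zero    = [] ∷ []
allStepSeqs-unique (suc n) = Unique.cartesianProductWith⁺ _∷_ ∷-injective
  (((λ ()) ∷ (λ ()) ∷ []) ∷ ((λ ()) ∷ []) ∷ [] ∷ []) (allStepSeqs-unique n)

∈-allStepSeqs⁺ : ∀ w → w ∈ allStepSeqs (length w)
∈-allStepSeqs⁺ []      = here refl
∈-allStepSeqs⁺ (s ∷ w) = ∈-cartesianProductWith⁺ _∷_ (step∈steps s) (∈-allStepSeqs⁺ w)

∈-allStepSeqs⁻ : ∀ n {w} → w ∈ allStepSeqs n → length w ≡ n
∈-allStepSeqs⁻ zero    (here refl) = refl
∈-allStepSeqs⁻ (suc n) w∈
  with _ , _ , _ , w′∈ , refl ← ∈-cartesianProductWith⁻ _∷_ (U ∷ F ∷ D ∷ []) (allStepSeqs n) w∈ =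
  cong suc (∈-allStepSeqs⁻ n w′∈)

motzkinWords : ℕ → List (List Step)
motzkinWords n = filterᵇ (isMotzkinFrom 0) (allStepSeqs n)

motzkinWords-unique : ∀ n → Unique (motzkinWords n)
motzkinWords-unique n = Unique.filter⁺ (T? ∘ isMotzkinFrom 0) (allStepSeqs-unique n)

path∈motzkinWords : ∀ t → path t ∈ motzkinWords (size t)
path∈motzkinWords t = ∈-filter⁺ (T? ∘ isMotzkinFrom 0)
  (subst (λ n → path t ∈ allStepSeqs n) (length-path t) (∈-allStepSeqs⁺ (path t)))
  (subst T (sym (isMotzkinFrom-pathOnto 0 t [])) tt)

motzkinWords-tree : ∀ n {w} → w ∈ motzkinWords n → path (tree w) ≡ w × size (tree w) ≡ n
motzkinWords-tree n {w} w∈ with w∈all , ok ← ∈-filter⁻ (T? ∘ isMotzkinFrom 0) {xs = allStepSeqs n} w∈ =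
  path-tree ok , trans (sym (length-path (tree w))) (trans (cong length (path-tree {w} ok)) (∈-allStepSeqs⁻ n w∈all))

values : ∀ {k m} → Vec (Fin k) m → List ℕ
values []      = []
values (x ∷ σ) = toℕ x ∷ values σ

length-values : ∀ {k m} (σ : Vec (Fin k) m) → length (values σ) ≡ m
length-values []      = refl
length-values (_ ∷ σ) = cong suc (length-values σ)

values-bounded : ∀ {k m} (σ : Vec (Fin k) m) → All (_< k) (values σ)
values-bounded []      = []
values-bounded (x ∷ σ) = toℕ<n x ∷ values-bounded σ

values-injective : ∀ {k m} {σ τ : Vec (Fin k) m} → values σ ≡ values τ → σ ≡ τ
values-injective {σ = []}    {[]}    _  = refl
values-injective {σ = _ ∷ _} {_ ∷ _} eq with x≡y , eq′ ← ∷-injective eq =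
  cong₂ _∷_ (toℕ-injective x≡y) (values-injective eq′)

-- Entries above k are truncated and missing ones padded with 0: junk that never occurs for
-- a list of length m with entries at most k.
toFins : ∀ {k} m → List ℕ → Vec (Fin (suc k)) m
toFins         zero    _        = []
toFins         (suc m) []       = Fin.zero ∷ toFins m []
toFins {k = k} (suc m) (x ∷ xs) = fromℕ< (s≤s (m⊓n≤n x k)) ∷ toFins m xs

fromValues : ∀ n → List ℕ → Vec (Fin n) n
fromValues zero    _ = []
fromValues (suc k) = toFins (suc k)

values-toFins : ∀ {k} m {xs} → length xs ≡ m → All (_< suc k) xs → values (toFins {k} m xs) ≡ xs
values-toFins zero    {[]}    _  _            = refl
values-toFins (suc m) {x ∷ xs} eq (x<1+k ∷ xs<1+k) =
  cong₂ _∷_ (trans (toℕ-fromℕ< _) (m≤n⇒m⊓n≡m (s≤s⁻¹ x<1+k))) (values-toFins m (suc-injective eq) xs<1+k)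

values-fromValues : ∀ {n xs} → length xs ≡ n → All (_< n) xs → values (fromValues n xs) ≡ xs
values-fromValues {zero}  {[]} _ _ = refl
values-fromValues {suc k} length≡ bounded = values-toFins (suc k) length≡ bounded

fromValues-values : ∀ {n} (σ : Vec (Fin n) n) → fromValues n (values σ) ≡ σ
fromValues-values σ = values-injective (values-fromValues (length-values σ) (values-bounded σ))

module _ {k : ℕ} where

  any⁻ : ∀ {m} {P : ℕ → Set} (σ : Vec (Fin k) m) → Any P (values σ) → ∃ λ j → P (toℕ (lookup σ j))
  any⁻ (_ ∷ σ) (here p)  = Fin.zero , p
  any⁻ (_ ∷ σ) (there a) with j , p ← any⁻ σ a = Fin.suc j , p

  any⁺ : ∀ {m} {P : ℕ → Set} (σ : Vec (Fin k) m) j → P (toℕ (lookup σ j)) → Any P (values σ)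
  any⁺ (_ ∷ σ) Fin.zero    p = here p
  any⁺ (_ ∷ σ) (Fin.suc j) p = there (any⁺ σ j p)

  values-unique⁺ : ∀ {m} (σ : Vec (Fin k) m) → (∀ i j → lookup σ i ≡ lookup σ j → i ≡ j) →
                   Unique (values σ)
  values-unique⁺ []      _   = []
  values-unique⁺ (x ∷ σ) inj =
    All.tabulate (λ v∈σ x≡v → let j , v≡σj = any⁻ σ v∈σ in
                   Finₚ.0≢1+n (inj Fin.zero (Fin.suc j) (toℕ-injective (trans x≡v v≡σj))))
    ∷ values-unique⁺ σ (λ i j eq → Finₚ.suc-injective (inj (Fin.suc i) (Fin.suc j) eq))

  values-unique⁻ : ∀ {m} (σ : Vec (Fin k) m) → Unique (values σ) →
                   ∀ i j → lookup σ i ≡ lookup σ j → i ≡ j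
  values-unique⁻ (_ ∷ σ) _          Fin.zero    Fin.zero    _  = refl
  values-unique⁻ (_ ∷ σ) (x∉σ ∷ _)  Fin.zero    (Fin.suc j) eq =
    ⊥-elim (All.lookup x∉σ (any⁺ σ j refl) (cong toℕ eq))
  values-unique⁻ (_ ∷ σ) (x∉σ ∷ _)  (Fin.suc i) Fin.zero    eq =
    ⊥-elim (All.lookup x∉σ (any⁺ σ i refl) (cong toℕ (sym eq)))
  values-unique⁻ (_ ∷ σ) (_ ∷ !σ)   (Fin.suc i) (Fin.suc j) eq = cong Fin.suc (values-unique⁻ σ !σ i j eq)

  Occurs312 : ∀ {m} → Vec (Fin k) m → Set
  Occurs312 {m} σ = ∃ λ (i : Fin m) → ∃ λ (j : Fin m) → ∃ λ (l : Fin m) →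
    toℕ i < toℕ j × toℕ j < toℕ l ×
    toℕ (lookup σ j) < toℕ (lookup σ l) × toℕ (lookup σ l) < toℕ (lookup σ i)

  Occurs123 : ∀ {m} → Vec (Fin k) m → Set
  Occurs123 {m} σ = ∃ λ (i : Fin m) → ∃ λ (j : Fin m) → ∃ λ (l : Fin m) →
    toℕ j ≡ suc (toℕ i) × toℕ l ≡ suc (toℕ j) ×
    toℕ (lookup σ i) < toℕ (lookup σ j) × toℕ (lookup σ j) < toℕ (lookup σ l)

  ascent⇒occurs : ∀ {m} {P : ℕ → Set} (σ : Vec (Fin k) m) → Ascent P (values σ) →
    ∃ λ j → ∃ λ l → toℕ j < toℕ l × toℕ (lookup σ j) < toℕ (lookup σ l) × P (toℕ (lookup σ l))
  ascent⇒occurs (_ ∷ σ) (here any) with l , x<σl , p ← any⁻ σ any = Fin.zero , Fin.suc l , z<s , x<σl , p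
  ascent⇒occurs (_ ∷ σ) (there asc) with j , l , j<l , σj<σl , p ← ascent⇒occurs σ asc =
    Fin.suc j , Fin.suc l , s<s j<l , σj<σl , p

  occurs⇒ascent : ∀ {m} {P : ℕ → Set} (σ : Vec (Fin k) m) j l → toℕ j < toℕ l →
    toℕ (lookup σ j) < toℕ (lookup σ l) → P (toℕ (lookup σ l)) → Ascent P (values σ)
  occurs⇒ascent (_ ∷ σ) Fin.zero    (Fin.suc l) _         x<σl  p = here (any⁺ σ l (x<σl , p))
  occurs⇒ascent (_ ∷ σ) (Fin.suc j) (Fin.suc l) (s<s j<l) σj<σl p = there (occurs⇒ascent σ j l j<l σj<σl p)

  has312⇒occurs : ∀ {m} (σ : Vec (Fin k) m) → Has312 (values σ) → Occurs312 σ
  has312⇒occurs (_ ∷ σ) (here asc) with j , l , j<l , σj<σl , σl<x ← ascent⇒occurs σ asc =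
    Fin.zero , Fin.suc j , Fin.suc l , z<s , s<s j<l , σj<σl , σl<x
  has312⇒occurs (_ ∷ σ) (there h) with i , j , l , i<j , j<l , σj<σl , σl<σi ← has312⇒occurs σ h =
    Fin.suc i , Fin.suc j , Fin.suc l , s<s i<j , s<s j<l , σj<σl , σl<σi

  occurs⇒has312 : ∀ {m} (σ : Vec (Fin k) m) → Occurs312 σ → Has312 (values σ)
  occurs⇒has312 (_ ∷ σ) (Fin.zero  , Fin.suc j , Fin.suc l , _         , s<s j<l , σj<σl , σl<x) =
    here (occurs⇒ascent σ j l j<l σj<σl σl<x)
  occurs⇒has312 (_ ∷ σ) (Fin.suc i , Fin.suc j , Fin.suc l , s<s i<j , s<s j<l , σj<σl , σl<σi) =
    there (occurs⇒has312 σ (i , j , l , i<j , j<l , σj<σl , σl<σi))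

  has123⇒occurs : ∀ {m} (σ : Vec (Fin k) m) → Has123 (values σ) → Occurs123 σ
  has123⇒occurs (_ ∷ _ ∷ _ ∷ _) (here a<b b<c) =
    Fin.zero , Fin.suc Fin.zero , Fin.suc (Fin.suc Fin.zero) , refl , refl , a<b , b<c
  has123⇒occurs (_ ∷ σ)         (there h) with i , j , l , j≡ , l≡ , a<b , b<c ← has123⇒occurs σ h =
    Fin.suc i , Fin.suc j , Fin.suc l , cong suc j≡ , cong suc l≡ , a<b , b<c

  occurs⇒has123 : ∀ {m} (σ : Vec (Fin k) m) → Occurs123 σ → Has123 (values σ)
  occurs⇒has123 (_ ∷ _ ∷ _ ∷ _) (Fin.zero , Fin.suc Fin.zero , Fin.suc (Fin.suc Fin.zero) , _ , _ , a<b , b<c) =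
    here a<b b<c
  occurs⇒has123 (_ ∷ _ ∷ [])     (Fin.zero , Fin.suc _ , Fin.suc Fin.zero , _ , () , _)
  occurs⇒has123 (_ ∷ σ) (Fin.suc i , Fin.suc j , Fin.suc l , j≡ , l≡ , a<b , b<c) =
    there (occurs⇒has123 σ (i , j , l , suc-injective j≡ , suc-injective l≡ , a<b , b<c))

map⁺-injectiveOn : ∀ {A B : Set} {f : A → B} {xs} →
  (∀ {x y} → x ∈ xs → y ∈ xs → f x ≡ f y → x ≡ y) → Unique xs → Unique (map f xs)
map⁺-injectiveOn inj []           = []
map⁺-injectiveOn inj (x∉xs ∷ !xs) =
  All.map⁺ (All.tabulate λ y∈xs fx≡fy → All.lookup x∉xs y∈xs (inj (here refl) (there y∈xs) fx≡fy))
  ∷ map⁺-injectiveOn (λ x∈ y∈ → inj (there x∈) (there y∈)) !xs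

characterisation : ∀ {n} (σ : Vec (Fin n) n) →
  (IsPerm σ × Avoids312 σ × Avoids123 σ) ⇔ (IsPermList n (values σ) × Avoiding (values σ))
characterisation σ = mk⇔
  (λ (inj , ¬312 , ¬123) →
    record { length≡ = length-values σ ; unique = values-unique⁺ σ inj ; bounded = values-bounded σ } ,
    ¬312 ∘ has312⇒occurs σ , ¬123 ∘ has123⇒occurs σ)
  (λ (π , ¬312 , ¬123) →
    values-unique⁻ σ (IsPermList.unique π) , ¬312 ∘ occurs⇒has312 σ , ¬123 ∘ occurs⇒has123 σ)

permOfWord : (n : ℕ) → List Step → Vec (Fin n) n
permOfWord n = fromValues n ∘ toPerm ∘ tree

module _ {n : ℕ} where

  tree-perm : ∀ {w} → w ∈ motzkinWords n → IsPermList n (toPerm (tree w))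
  tree-perm {w} w∈ =
    subst (λ m → IsPermList m (toPerm (tree w))) (proj₂ (motzkinWords-tree n w∈)) (toPerm-perm (tree w))

  values-permOfWord : ∀ {w} → w ∈ motzkinWords n → values (permOfWord n w) ≡ toPerm (tree w)
  values-permOfWord w∈ = values-fromValues (IsPermList.length≡ (tree-perm w∈)) (IsPermList.bounded (tree-perm w∈))

  permOfWord-injectiveOn : ∀ {w w′} → w ∈ motzkinWords n → w′ ∈ motzkinWords n →
                           permOfWord n w ≡ permOfWord n w′ → w ≡ w′
  permOfWord-injectiveOn {w} {w′} w∈ w′∈ eq = begin
    w               ≡⟨ proj₁ (motzkinWords-tree n w∈) ⟨
    path (tree w)   ≡⟨ cong path (toPerm-injective (begin
      toPerm (tree w)          ≡⟨ values-permOfWord w∈ ⟨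
      values (permOfWord n w)  ≡⟨ cong values eq ⟩
      values (permOfWord n w′) ≡⟨ values-permOfWord w′∈ ⟩
      toPerm (tree w′)         ∎)) ⟩
    path (tree w′)  ≡⟨ proj₁ (motzkinWords-tree n w′∈) ⟩
    w′              ∎
    where open ≡-Reasoning

  ∈-map-permOfWord : ∀ σ → σ ∈ map (permOfWord n) (motzkinWords n) ⇔
                            (IsPermList n (values σ) × Avoiding (values σ))
  ∈-map-permOfWord σ = mk⇔ to from
    where
    to : σ ∈ map (permOfWord n) (motzkinWords n) → IsPermList n (values σ) × Avoiding (values σ)
    to σ∈ with w , w∈ , refl ← ∈-map⁻ (permOfWord n) σ∈ =
      subst (λ xs → IsPermList n xs × Avoiding xs) (sym (values-permOfWord w∈))
            (tree-perm w∈ , toPerm-avoiding (tree w))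
    from : IsPermList n (values σ) × Avoiding (values σ) → σ ∈ map (permOfWord n) (motzkinWords n)
    from (π , av) with t , toPerm-t≡ ← toPerm-surjective π av =
      subst (_∈ map (permOfWord n) (motzkinWords n)) permOfWord-path (∈-map⁺ (permOfWord n) path∈)
      where
      size≡ : size t ≡ n
      size≡ = trans (sym (IsPermList.length≡ (toPerm-perm t)))
                    (trans (cong length toPerm-t≡) (IsPermList.length≡ π))
      path∈ : path t ∈ motzkinWords n
      path∈ = subst (λ m → path t ∈ motzkinWords m) size≡ (path∈motzkinWords t)
      permOfWord-path : permOfWord n (path t) ≡ σ
      permOfWord-path = trans (cong (fromValues n ∘ toPerm) (tree-path t))
                              (trans (cong (fromValues n) toPerm-t≡) (fromValues-values σ))

proposition9 : (n : ℕ) →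
    Σ (List (Vec (Fin n) n)) (λ L →
      Unique L ×
      ((σ : Vec (Fin n) n) → (σ ∈ L) ⇔ (IsPerm σ × Avoids312 σ × Avoids123 σ)) ×
      length L ≡ motzkin n)
proposition9 n =
  map (permOfWord n) (motzkinWords n) ,
  map⁺-injectiveOn permOfWord-injectiveOn (motzkinWords-unique n) ,
  (λ σ → ⇔.trans (∈-map-permOfWord σ) (⇔.sym (characterisation σ))) ,
  length-map (permOfWord n) (motzkinWords n)
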